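{- Let $d\ge0$, $\mathbb{F}$ a field, $V$ an $\mathbb{F}$-vector space of dimension $d+1$, $T\in{\rm Mat}_{d+1}(\mathbb{F})$ invertible upper triangular, $\{u_i\}_{i=0}^d$ a basis of $V$ and $v_j=\sum_iT_{ij}u_i$. Define $U'_i=\mathbb{F}u_d+\cdots+\mathbb{F}u_{d-i}$ and $U''_i=\mathbb{F}v_d+\cdots+\mathbb{F}v_{d-i}$ for $0\le i\le d$. Then the flags $\{U'_i\}_{i=0}^d$ and $\{U''_i\}_{i=0}^d$ are opposite if and only if $T$ is good.
   Context: Matrices are indexed by $0,\dots,d$; for $0\le i\le j\le d$, $T[i,j]$ is the submatrix with rows $0,\dots,j-i$ and columns $i,\dots,j$. $T$ is good if $T[i,d]$ is invertible for all $0\le i\le d$. Two flags $\{W_i\}_{i=0}^d,\{W'_i\}_{i=0}^d$ on $V$ (sequences of nested subspaces with $\dim W_i=i+1$) are opposite if $W_i\cap W'_j=0$ whenever $i+j<d$. -}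

module Defs where

open import Level using (Level; _⊔_) renaming (suc to lsuc)
open import Data.Nat using (ℕ; zero; suc; _∸_) renaming (_+_ to _+ℕ_; _<_ to _<ℕ_)
open import Data.Nat.Properties using (m∸n≤m; m+[n∸m]≡n)
open import Data.Fin using (Fin; zero; suc; toℕ; inject≤; cast; _↑ʳ_)
open import Data.Fin.Properties using (toℕ≤n)
open import Data.Product using (Σ; ∃; _×_; _,_)
open import Relation.Nullary using (¬_)
open import Algebra.Bundles using (CommutativeRing)
open import Algebra.Module.Bundles using (Module)

record Field (c ℓ : Level) : Set (lsuc (c ⊔ ℓ)) where
  field
    commutativeRing : CommutativeRing c ℓ
  open CommutativeRing commutativeRing public
  field
    0≉1     : ¬ (0# ≈ 1#)
    inverse : ∀ x → ¬ (x ≈ 0#) → ∃ λ y → x * y ≈ 1#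

bigSum : ∀ {a} {A : Set a} → (A → A → A) → A → ∀ {n} → (Fin n → A) → A
bigSum _⊕_ e {zero}  f = e
bigSum _⊕_ e {suc n} f = f zero ⊕ bigSum _⊕_ e (λ k → f (suc k))

module FieldNotions {c ℓ : Level} (F : Field c ℓ) where
  open Field F

  -- square matrices of size n, indexed by Fin n (rows, then columns)
  Mat : ℕ → Set c
  Mat n = Fin n → Fin n → Carrier

  Σᶠ : ∀ {n} → (Fin n → Carrier) → Carrier
  Σᶠ = bigSum _+_ 0#

  _⊗_ : ∀ {n} → Mat n → Mat n → Mat n
  (A ⊗ B) i j = Σᶠ (λ k → A i k * B k j)

  IdMat : ∀ {n} → Mat n
  IdMat zero    zero    = 1#
  IdMat zero    (suc j) = 0#
  IdMat (suc i) zero    = 0#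
  IdMat (suc i) (suc j) = IdMat i j

  _≈ᴹᵃᵗ_ : ∀ {n} → Mat n → Mat n → Set ℓ
  A ≈ᴹᵃᵗ B = ∀ i j → A i j ≈ B i j

  Invertible : ∀ {n} → Mat n → Set (c ⊔ ℓ)
  Invertible A = ∃ λ B → ((A ⊗ B) ≈ᴹᵃᵗ IdMat) × ((B ⊗ A) ≈ᴹᵃᵗ IdMat)

  UpperTriangular : ∀ {n} → Mat n → Set ℓ
  UpperTriangular A = ∀ i j → toℕ j <ℕ toℕ i → A i j ≈ 0#

  -- T[i,d] : rows 0..d-i, columns i..d  (a (d-i+1)×(d-i+1) matrix)
  subBlock : ∀ {d} → Mat (suc d) → (i : Fin (suc d)) → Mat (suc d ∸ toℕ i)
  subBlock {d} T i r s =
    T (inject≤ r (m∸n≤m (suc d) (toℕ i)))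
      (cast (m+[n∸m]≡n (toℕ≤n i)) (toℕ i ↑ʳ s))

  Good : ∀ {d} → Mat (suc d) → Set (c ⊔ ℓ)
  Good {d} T = ∀ (i : Fin (suc d)) → Invertible (subBlock T i)

  module VectorSpace {m ℓm : Level} (V : Module commutativeRing m ℓm) where
    open Module V using (Carrierᴹ; _≈ᴹ_; _+ᴹ_; 0ᴹ; _*ₗ_)

    lincomb : ∀ {n} → (Fin n → Carrier) → (Fin n → Carrierᴹ) → Carrierᴹ
    lincomb coef w = bigSum _+ᴹ_ 0ᴹ (λ k → coef k *ₗ w k)

    LinearlyIndependent : ∀ {n} → (Fin n → Carrierᴹ) → Set (c ⊔ ℓ ⊔ ℓm)
    LinearlyIndependent w = ∀ coef → lincomb coef w ≈ᴹ 0ᴹ → ∀ k → coef k ≈ 0#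

    Spanning : ∀ {n} → (Fin n → Carrierᴹ) → Set (c ⊔ m ⊔ ℓm)
    Spanning w = ∀ x → ∃ λ coef → x ≈ᴹ lincomb coef w

    IsBasis : ∀ {n} → (Fin n → Carrierᴹ) → Set (c ⊔ ℓ ⊔ m ⊔ ℓm)
    IsBasis w = LinearlyIndependent w × Spanning w

    Subspace : Set (lsuc (c ⊔ ℓ ⊔ ℓm) ⊔ m)
    Subspace = Carrierᴹ → Set (c ⊔ ℓ ⊔ ℓm)

    Opposite : ∀ {d} → (Fin (suc d) → Subspace) → (Fin (suc d) → Subspace) → Set (c ⊔ ℓ ⊔ m ⊔ ℓm)
    Opposite {d} W W' = ∀ (i j : Fin (suc d)) → toℕ i +ℕ toℕ j <ℕ d →
                        ∀ x → W i x → W' j x → x ≈ᴹ 0ᴹ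

    -- span of {w_d, w_{d-1}, ..., w_{d-i}}  (i.e. of the w_k with k ≥ d - i)
    topSpan : ∀ {d} → (Fin (suc d) → Carrierᴹ) → Fin (suc d) → Subspace
    topSpan {d} w i x = ∃ λ coef → (∀ k → toℕ k +ℕ toℕ i <ℕ d → coef k ≈ 0#)
                                   × x ≈ᴹ lincomb coef w

    transformBasis : ∀ {d} → Mat (suc d) → (Fin (suc d) → Carrierᴹ) → Fin (suc d) → Carrierᴹ
    transformBasis T u j = lincomb (λ i → T i j) u

-- Both conditions are compared with a third one: every block T[k,d] is INJECTIVE.
-- * Opposite ⇔ injective blocks.  A vector x = Σ b_l v_l with b_l = 0 for l < q
--   has u-coordinates T b, and its rows 0..d-q only see T[q,d] applied to
--   (b_q, ..., b_d).  So a kernel vector of T[q,d] gives an element of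
--   U'_{q-1} ∩ U''_{d-q}, and conversely an element of U'_i ∩ U''_j yields a
--   kernel vector of T[d-j,d].
-- * Good ⇔ injective blocks.  Invertible matrices are injective.  Conversely the
--   blocks are nested: T[k,d] is T[k+1,d] bordered by one column on the left and
--   one row at the bottom, and a bordered matrix that is injective, with invertible
--   inner block, is invertible (Schur complement).  Induction on k downwards
--   from d+1 makes all blocks invertible.
module Submission where

open import Defs
open import Level using (Level; _⊔_)
open import Data.Nat using (ℕ; zero; suc; _≤_; _<_; _∸_; _≟_; z≤n; s≤s) renaming (_+_ to _+ℕ_)
import Data.Nat.Properties as ℕₚ
open import Data.Fin using (Fin; toℕ; fromℕ<) renaming (zero to fzero; suc to fsuc)
open import Data.Fin.Properties using (toℕ<n; toℕ-fromℕ<; toℕ-inject≤; toℕ-cast; toℕ-↑ʳ)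
open import Data.Product using (Σ; ∃; _×_; _,_; proj₁; proj₂)
open import Data.Sum using (_⊎_; inj₁; inj₂)
open import Data.Empty using (⊥-elim)
open import Relation.Nullary using (¬_; Dec; yes; no)
open import Relation.Binary.PropositionalEquality as ≡ using (_≡_; _≢_; cong)
open import Function using (_∘_)
open import Function.Bundles using (_⇔_; mk⇔)
open import Algebra.Bundles using (CommutativeMonoid)
open import Algebra.Module.Bundles using (Module)

below-or-last : ∀ {m} (a : Fin (suc m)) → (Σ (Fin m) λ a' → toℕ a ≡ toℕ a') ⊎ (toℕ a ≡ m)
below-or-last {zero}  fzero    = inj₂ ≡.refl
below-or-last {suc m} fzero    = inj₁ (fzero , ≡.refl)
below-or-last {suc m} (fsuc a) with below-or-last a
... | inj₁ (a' , e) = inj₁ (fsuc a' , cong suc e)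
... | inj₂ e        = inj₂ (cong suc e)

toℕ≢bound : ∀ {m} (a : Fin m) → toℕ a ≢ m
toℕ≢bound a e = ℕₚ.<-irrefl e (toℕ<n a)

at-fromℕ< : ∀ {n p} {P : ℕ → Set p} → (∀ (l : Fin n) → P (toℕ l)) → ∀ r → r < n → P r
at-fromℕ< {P = P} h r r<n = ≡.subst P (toℕ-fromℕ< r<n) (h (fromℕ< r<n))

-- Linear algebra over a field F with matrices and vectors indexed by ℕ; only
-- the top-left p × p block of a matrix matters for a statement "of size p".
-- This avoids the index casts that Fin-indexed submatrices would require.
module MatrixAlgebra {c ℓ} (F : Field c ℓ) where
  open Field F
  open import Algebra.Properties.Semiring.Sum semiring
    using (sum; sum-cong-≋; ∑-distrib-+; ∑-comm; sum-replicate-zero; *-distribˡ-sum; *-distribʳ-sum)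
  open import Algebra.Properties.Ring ring using (-‿distribˡ-*; -‿distribʳ-*; -1*x≈-x)
  open import Relation.Binary.Reasoning.Setoid setoid
  open import Algebra.Solver.Ring.NaturalCoefficients.Default commutativeSemiring
    using (solve; _:=_; _:+_; _:*_)

  Vec∞ : Set c
  Vec∞ = ℕ → Carrier

  Mat∞ : Set c
  Mat∞ = ℕ → ℕ → Carrier

  ∑ : ℕ → Vec∞ → Carrier
  ∑ p f = sum {p} (λ k → f (toℕ k))

  -- Stated for Fin-indexed summands, which Agda can infer from the goal.
  ∑-cong : ∀ p {f g : Fin p → Carrier} → (∀ k → f k ≈ g k) → sum f ≈ sum g
  ∑-cong p h = sum-cong-≋ {p} h

  ∑-+ : ∀ p (f g : Vec∞) → ∑ p (λ k → f k + g k) ≈ ∑ p f + ∑ p g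
  ∑-+ p f g = ∑-distrib-+ {p} (f ∘ toℕ) (g ∘ toℕ)

  ∑-*ˡ : ∀ p a (f : Vec∞) → ∑ p (λ k → a * f k) ≈ a * ∑ p f
  ∑-*ˡ p a f = sym (*-distribˡ-sum {p} a (f ∘ toℕ))

  ∑-*ʳ : ∀ p a (f : Vec∞) → ∑ p (λ k → f k * a) ≈ ∑ p f * a
  ∑-*ʳ p a f = sym (*-distribʳ-sum {p} a (f ∘ toℕ))

  ∑-zero : ∀ p {f : Fin p → Carrier} → (∀ k → f k ≈ 0#) → sum f ≈ 0#
  ∑-zero p h = trans (∑-cong p h) (sum-replicate-zero p)

  ∑-swap : ∀ p q (H : Mat∞) → ∑ p (λ i → ∑ q (H i)) ≈ ∑ q (λ j → ∑ p (λ i → H i j))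
  ∑-swap p q H = ∑-comm {p} {q} (λ i j → H (toℕ i) (toℕ j))

  ∑-neg : ∀ p (f : Vec∞) → ∑ p (λ k → - f k) ≈ - ∑ p f
  ∑-neg p f = begin
    ∑ p (λ k → - f k)      ≈⟨ ∑-cong p (λ k → sym (-1*x≈-x (f (toℕ k)))) ⟩
    ∑ p (λ k → - 1# * f k) ≈⟨ ∑-*ˡ p (- 1#) f ⟩
    - 1# * ∑ p f           ≈⟨ -1*x≈-x _ ⟩
    - ∑ p f                ∎

  ∑-last : ∀ p (f : Vec∞) → ∑ (suc p) f ≈ ∑ p f + f p
  ∑-last zero    f = trans (+-identityʳ (f 0)) (sym (+-identityˡ (f 0)))
  ∑-last (suc p) f = trans (+-congˡ (∑-last p (f ∘ suc))) (sym (+-assoc _ _ _))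

  ∑-skip : ∀ q p (f : Vec∞) → (∀ (k : Fin q) → f (toℕ k) ≈ 0#) → ∑ (q +ℕ p) f ≈ ∑ p (λ s → f (q +ℕ s))
  ∑-skip zero    p f h = refl
  ∑-skip (suc q) p f h =
    trans (+-cong (h fzero) (∑-skip q p (f ∘ suc) (h ∘ fsuc))) (+-identityˡ _)

  ∑-assoc : ∀ p q (X : Vec∞) (Y : Mat∞) (Z : Vec∞) →
    ∑ p (λ k → X k * ∑ q (λ j → Y k j * Z j)) ≈ ∑ q (λ j → ∑ p (λ k → X k * Y k j) * Z j)
  ∑-assoc p q X Y Z = begin
    ∑ p (λ k → X k * ∑ q (λ j → Y k j * Z j))
      ≈⟨ ∑-cong p (λ k → sym (∑-*ˡ q (X (toℕ k)) (λ j → Y (toℕ k) j * Z j))) ⟩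
    ∑ p (λ k → ∑ q (λ j → X k * (Y k j * Z j)))
      ≈⟨ ∑-swap p q (λ k j → X k * (Y k j * Z j)) ⟩
    ∑ q (λ j → ∑ p (λ k → X k * (Y k j * Z j)))
      ≈⟨ ∑-cong q (λ j → trans (∑-cong p (λ k → sym (*-assoc _ _ _)))
                               (∑-*ʳ p (Z (toℕ j)) (λ k → X k * Y k (toℕ j)))) ⟩
    ∑ q (λ j → ∑ p (λ k → X k * Y k j) * Z j) ∎

  δ : Mat∞
  δ zero    zero    = 1#
  δ zero    (suc _) = 0#
  δ (suc _) zero    = 0#
  δ (suc r) (suc s) = δ r s

  δ-sym : ∀ r s → δ r s ≡ δ s r
  δ-sym zero    zero    = ≡.refl
  δ-sym zero    (suc s) = ≡.refl
  δ-sym (suc r) zero    = ≡.refl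
  δ-sym (suc r) (suc s) = δ-sym r s

  δ-≢ : ∀ r s → r ≢ s → δ r s ≡ 0#
  δ-≢ zero    zero    r≢s = ⊥-elim (r≢s ≡.refl)
  δ-≢ zero    (suc s) r≢s = ≡.refl
  δ-≢ (suc r) zero    r≢s = ≡.refl
  δ-≢ (suc r) (suc s) r≢s = δ-≢ r s (r≢s ∘ cong suc)

  δ-refl : ∀ r → δ r r ≡ 1#
  δ-refl zero    = ≡.refl
  δ-refl (suc r) = δ-refl r

  δ-selectˡ : ∀ p (a : Fin p) (f : Vec∞) → ∑ p (λ j → δ (toℕ a) j * f j) ≈ f (toℕ a)
  δ-selectˡ (suc p) fzero    f = trans (+-cong (*-identityˡ _) (∑-zero p (λ k → zeroˡ _))) (+-identityʳ _)
  δ-selectˡ (suc p) (fsuc a) f = trans (+-cong (zeroˡ _) (δ-selectˡ p a (f ∘ suc))) (+-identityˡ _)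

  δ-selectʳ : ∀ p (a : Fin p) (f : Vec∞) → ∑ p (λ k → f k * δ k (toℕ a)) ≈ f (toℕ a)
  δ-selectʳ p a f = trans (∑-cong p swapped) (δ-selectˡ p a f)
    where
    swapped : ∀ (k : Fin p) → f (toℕ k) * δ (toℕ k) (toℕ a) ≈ δ (toℕ a) (toℕ k) * f (toℕ k)
    swapped k = trans (*-comm _ _) (reflexive (cong (_* f (toℕ k)) (δ-sym (toℕ k) (toℕ a))))

  IsInverse : ℕ → Mat∞ → Mat∞ → Set ℓ
  IsInverse p A P = (∀ (a b : Fin p) → ∑ p (λ k → A (toℕ a) k * P k (toℕ b)) ≈ δ (toℕ a) (toℕ b))
                  × (∀ (a b : Fin p) → ∑ p (λ k → P (toℕ a) k * A k (toℕ b)) ≈ δ (toℕ a) (toℕ b))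

  Injective : ℕ → Mat∞ → Set (c ⊔ ℓ)
  Injective p A = ∀ (x : Vec∞) → (∀ (a : Fin p) → ∑ p (λ s → A (toℕ a) s * x s) ≈ 0#) →
                  ∀ (a : Fin p) → x (toℕ a) ≈ 0#

  IsInverse-cong : ∀ {p A A' P} → (∀ r s → A r s ≈ A' r s) → IsInverse p A P → IsInverse p A' P
  IsInverse-cong {p} A≈A' (AP , PA) =
    (λ a b → trans (∑-cong p (λ k → *-congʳ (sym (A≈A' _ _)))) (AP a b)) ,
    (λ a b → trans (∑-cong p (λ k → *-congˡ (sym (A≈A' _ _)))) (PA a b))

  inverse-cancelˡ : ∀ {p A P} → IsInverse p A P → ∀ (v : Vec∞) (a : Fin p) →
                    ∑ p (λ k → A (toℕ a) k * ∑ p (λ j → P k j * v j)) ≈ v (toℕ a)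
  inverse-cancelˡ {p} {A} {P} (AP , _) v a =
    trans (∑-assoc p p (A (toℕ a)) P v) (trans (∑-cong p (λ j → *-congʳ (AP a j))) (δ-selectˡ p a v))

  inverse-cancelʳ : ∀ {p A P} → IsInverse p A P → ∀ (v : Vec∞) (b : Fin p) →
                    ∑ p (λ r → ∑ p (λ k → v k * P k r) * A r (toℕ b)) ≈ v (toℕ b)
  inverse-cancelʳ {p} {A} {P} (_ , PA) v b =
    trans (sym (∑-assoc p p v P (λ r → A r (toℕ b))))
          (trans (∑-cong p (λ k → *-congˡ (PA k b))) (δ-selectʳ p b v))

  inverse⇒injective : ∀ {p A P} → IsInverse p A P → Injective p A
  inverse⇒injective {p} {A} {P} (_ , PA) x Ax≈0 a = begin
    x (toℕ a)                                          ≈⟨ sym (δ-selectˡ p a x) ⟩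
    ∑ p (λ j → δ (toℕ a) j * x j)                      ≈⟨ ∑-cong p (λ j → *-congʳ (sym (PA a j))) ⟩
    ∑ p (λ j → ∑ p (λ k → P (toℕ a) k * A k j) * x j) ≈⟨ sym (∑-assoc p p (P (toℕ a)) A x) ⟩
    ∑ p (λ k → P (toℕ a) k * ∑ p (λ j → A k j * x j)) ≈⟨ ∑-zero p (λ k → trans (*-congˡ (Ax≈0 k)) (zeroʳ _)) ⟩
    0#                                                 ∎

  -- Let M be (m+1) × (m+1), written in blocks as
  --      M = ( col    A   )      (first column, then m further columns;
  --          ( corner row )       first m rows, then the last row),
  -- with A invertible (inverse P) and M injective.  Then M is invertible:
  -- with y = P col, z = row P and the Schur complement σ = corner - row y,
  -- injectivity forces σ ≠ 0 (else (1, -y) is in the kernel), and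
  --      M⁻¹ = ( -σ⁻¹ z         σ⁻¹    )    (first row, then m rows;
  --            ( P + y σ⁻¹ z    -y σ⁻¹ )     first m columns, then the last).
  module Bordering (m : ℕ) (M P : Mat∞)
                   (A-inv : IsInverse m (λ r s → M r (suc s)) P) (M-inj : Injective (suc m) M) where
    open import Algebra.Properties.AbelianGroup +-abelianGroup using (⁻¹-∙-comm)
    open import Algebra.Properties.Group +-group using (⁻¹-involutive)

    A : Mat∞
    A r s = M r (suc s)
    col row : Vec∞
    col r = M r 0
    row s = M m (suc s)
    corner : Carrier
    corner = M m 0

    y z : Vec∞
    y s = ∑ m (λ r → P s r * col r)
    z r = ∑ m (λ s → row s * P s r)

    row·y : Carrier
    row·y = ∑ m (λ s → row s * y s)

    σ : Carrier
    σ = corner + - row·y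

    A·y≈col : ∀ (a : Fin m) → ∑ m (λ k → A (toℕ a) k * y k) ≈ col (toℕ a)
    A·y≈col = inverse-cancelˡ {m} {A} {P} A-inv col

    z·A≈row : ∀ (q : Fin m) → ∑ m (λ r → z r * A r (toℕ q)) ≈ row (toℕ q)
    z·A≈row = inverse-cancelʳ {m} {A} {P} A-inv row

    z·col≈row·y : ∑ m (λ r → z r * col r) ≈ row·y
    z·col≈row·y = sym (∑-assoc m m row P col)

    kernel : Vec∞
    kernel zero    = 1#
    kernel (suc s) = - y s

    ∑-*-neg-y : ∀ (X : Vec∞) → ∑ m (λ s → X s * - y s) ≈ - ∑ m (λ s → X s * y s)
    ∑-*-neg-y X = trans (∑-cong m (λ k → sym (-‿distribʳ-* _ _))) (∑-neg m (λ s → X s * y s))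

    kernel-upper : ∀ (a : Fin m) → ∑ (suc m) (λ s → M (toℕ a) s * kernel s) ≈ 0#
    kernel-upper a = begin
      M (toℕ a) 0 * 1# + ∑ m (λ s → A (toℕ a) s * - y s)
        ≈⟨ +-cong (*-identityʳ _) (∑-*-neg-y (A (toℕ a))) ⟩
      col (toℕ a) + - ∑ m (λ s → A (toℕ a) s * y s) ≈⟨ +-congˡ (-‿cong (A·y≈col a)) ⟩
      col (toℕ a) + - col (toℕ a)                   ≈⟨ -‿inverseʳ _ ⟩
      0#                                            ∎

    kernel-in-kernel : σ ≈ 0# → ∀ (a : Fin (suc m)) → ∑ (suc m) (λ s → M (toℕ a) s * kernel s) ≈ 0#
    kernel-in-kernel σ≈0 a with below-or-last a
    ... | inj₁ (a' , e) rewrite e = kernel-upper a'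
    ... | inj₂ e        rewrite e = trans (+-cong (*-identityʳ _) (∑-*-neg-y row)) σ≈0

    -- Injectivity of M: its kernel vector (1, -y) would have first entry 0.
    σ≉0 : ¬ σ ≈ 0#
    σ≉0 σ≈0 = 0≉1 (sym (M-inj kernel (kernel-in-kernel σ≈0) fzero))

    σ⁻¹ : Carrier
    σ⁻¹ = proj₁ (inverse σ σ≉0)

    σσ⁻¹ : σ * σ⁻¹ ≈ 1#
    σσ⁻¹ = proj₂ (inverse σ σ≉0)

    -σ⁻¹ : Carrier
    -σ⁻¹ = - σ⁻¹

    σ⁻¹-σ⁻¹ : σ⁻¹ + -σ⁻¹ ≈ 0#
    σ⁻¹-σ⁻¹ = -‿inverseʳ σ⁻¹

    schur-one : corner * σ⁻¹ + row·y * -σ⁻¹ ≈ 1#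
    schur-one = begin
      corner * σ⁻¹ + row·y * -σ⁻¹      ≈⟨ +-congˡ (trans (sym (-‿distribʳ-* _ _)) (-‿distribˡ-* _ _)) ⟩
      corner * σ⁻¹ + (- row·y) * σ⁻¹   ≈⟨ sym (distribʳ σ⁻¹ corner (- row·y)) ⟩
      σ * σ⁻¹                          ≈⟨ σσ⁻¹ ⟩
      1#                               ∎

    schur-minus-one : corner * -σ⁻¹ + row·y * σ⁻¹ ≈ - 1#
    schur-minus-one = begin
      corner * -σ⁻¹ + row·y * σ⁻¹       ≈⟨ +-cong (sym (-‿distribʳ-* _ _))
                                                  (sym (trans (-‿distribˡ-* (- row·y) σ⁻¹)
                                                              (*-congʳ (⁻¹-involutive row·y)))) ⟩
      - (corner * σ⁻¹) + - ((- row·y) * σ⁻¹) ≈⟨ ⁻¹-∙-comm _ _ ⟩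
      - (corner * σ⁻¹ + (- row·y) * σ⁻¹)   ≈⟨ -‿cong (sym (distribʳ σ⁻¹ corner (- row·y))) ⟩
      - (σ * σ⁻¹)                           ≈⟨ -‿cong σσ⁻¹ ⟩
      - 1#                                  ∎

    x-x≈0 : ∀ x → x + x * (- 1#) ≈ 0#
    x-x≈0 x = trans (+-congˡ (trans (sym (-‿distribʳ-* x 1#)) (-‿cong (*-identityʳ x)))) (-‿inverseʳ x)

    lastCol : Vec∞
    lastCol zero    = σ⁻¹
    lastCol (suc s) = y s * -σ⁻¹

    otherCol : Mat∞
    otherCol zero    r = -σ⁻¹ * z r
    otherCol (suc s) r = P s r + y s * σ⁻¹ * z r

    pick : ∀ {r} → Dec (r ≡ m) → Vec∞
    pick (yes _)     k = lastCol k
    pick {r} (no _)  k = otherCol k r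

    N : Mat∞
    N k r = pick (r ≟ m) k

    N-last : ∀ k → N k m ≡ lastCol k
    N-last k with m ≟ m
    ... | yes _  = ≡.refl
    ... | no m≢m = ⊥-elim (m≢m ≡.refl)

    N-other : ∀ k (r : Fin m) → N k (toℕ r) ≡ otherCol k (toℕ r)
    N-other k r with toℕ r ≟ m
    ... | yes r≡m = ⊥-elim (toℕ≢bound r r≡m)
    ... | no _    = ≡.refl

    ∑-*-y·c : ∀ (X : Vec∞) c → ∑ m (λ k → X k * (y k * c)) ≈ ∑ m (λ k → X k * y k) * c
    ∑-*-y·c X c = trans (∑-cong m (λ k → sym (*-assoc _ _ _))) (∑-*ʳ m c (λ k → X k * y k))

    M·lastCol : ∀ (a : Fin (suc m)) → ∑ (suc m) (λ k → M (toℕ a) k * lastCol k) ≈ δ (toℕ a) m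
    M·lastCol a with below-or-last a
    ... | inj₁ (a' , e) rewrite e = begin
      col r * σ⁻¹ + ∑ m (λ k → A r k * (y k * -σ⁻¹)) ≈⟨ +-congˡ (∑-*-y·c (A r) -σ⁻¹) ⟩
      col r * σ⁻¹ + ∑ m (λ k → A r k * y k) * -σ⁻¹   ≈⟨ +-congˡ (*-congʳ (A·y≈col a')) ⟩
      col r * σ⁻¹ + col r * -σ⁻¹                     ≈⟨ sym (distribˡ _ _ _) ⟩
      col r * (σ⁻¹ + -σ⁻¹)                           ≈⟨ trans (*-congˡ σ⁻¹-σ⁻¹) (zeroʳ _) ⟩
      0#                                             ≡⟨ ≡.sym (δ-≢ r m (toℕ≢bound a')) ⟩
      δ r m                                          ∎
      where r = toℕ a'
    ... | inj₂ e rewrite e = begin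
      corner * σ⁻¹ + ∑ m (λ k → row k * (y k * -σ⁻¹)) ≈⟨ +-congˡ (∑-*-y·c row -σ⁻¹) ⟩
      corner * σ⁻¹ + row·y * -σ⁻¹                     ≈⟨ schur-one ⟩
      1#                                              ≡⟨ ≡.sym (δ-refl m) ⟩
      δ m m                                           ∎

    M·otherCol-expand : ∀ r s → ∑ (suc m) (λ k → M r k * otherCol k s) ≈
      M r 0 * (-σ⁻¹ * z s) + (∑ m (λ k → A r k * P k s) + ∑ m (λ k → A r k * y k) * (σ⁻¹ * z s))
    M·otherCol-expand r s = +-congˡ (begin
      ∑ m (λ k → A r k * (P k s + y k * σ⁻¹ * z s))
        ≈⟨ ∑-cong m (λ k → distribute (A r (toℕ k)) _ _ σ⁻¹ (z s)) ⟩
      ∑ m (λ k → A r k * P k s + (A r k * y k) * (σ⁻¹ * z s))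
        ≈⟨ ∑-+ m (λ k → A r k * P k s) (λ k → (A r k * y k) * (σ⁻¹ * z s)) ⟩
      ∑ m (λ k → A r k * P k s) + ∑ m (λ k → (A r k * y k) * (σ⁻¹ * z s))
        ≈⟨ +-congˡ (∑-*ʳ m (σ⁻¹ * z s) (λ k → A r k * y k)) ⟩
      ∑ m (λ k → A r k * P k s) + ∑ m (λ k → A r k * y k) * (σ⁻¹ * z s) ∎)
      where
      distribute : ∀ a p y s z → a * (p + y * s * z) ≈ a * p + (a * y) * (s * z)
      distribute = solve 5 (λ a p y s z → a :* (p :+ y :* s :* z) := a :* p :+ (a :* y) :* (s :* z)) refl

    M·otherCol : ∀ (a : Fin (suc m)) (b : Fin m) →
                 ∑ (suc m) (λ k → M (toℕ a) k * otherCol k (toℕ b)) ≈ δ (toℕ a) (toℕ b)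
    M·otherCol a b with below-or-last a
    ... | inj₁ (a' , e) rewrite e = begin
      _ ≈⟨ M·otherCol-expand (toℕ a') (toℕ b) ⟩
      C * (-σ⁻¹ * Z) + (∑ m (λ k → A (toℕ a') k * P k (toℕ b)) + ∑ m (λ k → A (toℕ a') k * y k) * (σ⁻¹ * Z))
        ≈⟨ +-congˡ (+-cong (proj₁ A-inv a' b) (*-congʳ (A·y≈col a'))) ⟩
      C * (-σ⁻¹ * Z) + (D + C * (σ⁻¹ * Z))
        ≈⟨ solve 5 (λ C Z D s n → C :* (n :* Z) :+ (D :+ C :* (s :* Z)) := D :+ (C :* Z) :* (s :+ n))
                   refl C Z D σ⁻¹ -σ⁻¹ ⟩
      D + (C * Z) * (σ⁻¹ + -σ⁻¹) ≈⟨ +-congˡ (trans (*-congˡ σ⁻¹-σ⁻¹) (zeroʳ _)) ⟩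
      D + 0#                     ≈⟨ +-identityʳ D ⟩
      D                          ∎
      where C = col (toℕ a'); Z = z (toℕ b); D = δ (toℕ a') (toℕ b)
    ... | inj₂ e rewrite e = begin
      _ ≈⟨ M·otherCol-expand m (toℕ b) ⟩
      corner * (-σ⁻¹ * Z) + (Z + row·y * (σ⁻¹ * Z))
        ≈⟨ solve 5 (λ c n Z y s → c :* (n :* Z) :+ (Z :+ y :* (s :* Z)) := Z :+ Z :* (c :* n :+ y :* s))
                   refl corner -σ⁻¹ Z row·y σ⁻¹ ⟩
      Z + Z * (corner * -σ⁻¹ + row·y * σ⁻¹) ≈⟨ +-congˡ (*-congˡ schur-minus-one) ⟩
      Z + Z * (- 1#)                        ≈⟨ x-x≈0 Z ⟩
      0#                                    ≡⟨ ≡.sym (δ-≢ m (toℕ b) (toℕ≢bound b ∘ ≡.sym)) ⟩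
      δ m (toℕ b)                           ∎
      where Z = z (toℕ b)

    M·N : ∀ (a b : Fin (suc m)) → ∑ (suc m) (λ k → M (toℕ a) k * N k (toℕ b)) ≈ δ (toℕ a) (toℕ b)
    M·N a b with below-or-last b
    ... | inj₂ e rewrite e =
      trans (∑-cong (suc m) (λ k → *-congˡ {M (toℕ a) (toℕ k)} (reflexive (N-last (toℕ k))))) (M·lastCol a)
    ... | inj₁ (b' , e) rewrite e =
      trans (∑-cong (suc m) (λ k → *-congˡ {M (toℕ a) (toℕ k)} (reflexive (N-other (toℕ k) b')))) (M·otherCol a b')

    otherCol-expand : ∀ s (C : Vec∞) → ∑ m (λ r → (P s r + y s * σ⁻¹ * z r) * C r) ≈
                      ∑ m (λ r → P s r * C r) + (y s * σ⁻¹) * ∑ m (λ r → z r * C r)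
    otherCol-expand s C = begin
      ∑ m (λ r → (P s r + y s * σ⁻¹ * z r) * C r)
        ≈⟨ ∑-cong m (λ r → distribute _ _ (z (toℕ r)) (C (toℕ r))) ⟩
      ∑ m (λ r → P s r * C r + (y s * σ⁻¹) * (z r * C r))
        ≈⟨ ∑-+ m (λ r → P s r * C r) (λ r → (y s * σ⁻¹) * (z r * C r)) ⟩
      ∑ m (λ r → P s r * C r) + ∑ m (λ r → (y s * σ⁻¹) * (z r * C r))
        ≈⟨ +-congˡ (∑-*ˡ m (y s * σ⁻¹) (λ r → z r * C r)) ⟩
      ∑ m (λ r → P s r * C r) + (y s * σ⁻¹) * ∑ m (λ r → z r * C r) ∎
      where
      distribute : ∀ p ys z c → (p + ys * z) * c ≈ p * c + ys * (z * c)
      distribute = solve 4 (λ p ys z c → (p :+ ys :* z) :* c := p :* c :+ ys :* (z :* c)) refl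

    N·M-split : ∀ (a b : Fin (suc m)) →
      ∑ m (λ r → otherCol (toℕ a) r * M r (toℕ b)) + lastCol (toℕ a) * M m (toℕ b) ≈ δ (toℕ a) (toℕ b)
    N·M-split fzero fzero = begin
      ∑ m (λ r → (-σ⁻¹ * z r) * col r) + σ⁻¹ * corner
        ≈⟨ +-congʳ (trans (∑-cong m (λ r → *-assoc _ _ _))
                          (trans (∑-*ˡ m -σ⁻¹ (λ r → z r * col r)) (*-congˡ z·col≈row·y))) ⟩
      -σ⁻¹ * row·y + σ⁻¹ * corner ≈⟨ trans (+-comm _ _) (+-cong (*-comm _ _) (*-comm _ _)) ⟩
      corner * σ⁻¹ + row·y * -σ⁻¹ ≈⟨ schur-one ⟩
      1#                          ∎
    N·M-split fzero (fsuc q) = begin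
      ∑ m (λ r → (-σ⁻¹ * z r) * A r (toℕ q)) + σ⁻¹ * row (toℕ q)
        ≈⟨ +-congʳ (trans (∑-cong m (λ r → *-assoc _ _ _))
                          (trans (∑-*ˡ m -σ⁻¹ (λ r → z r * A r (toℕ q))) (*-congˡ (z·A≈row q)))) ⟩
      -σ⁻¹ * row (toℕ q) + σ⁻¹ * row (toℕ q) ≈⟨ sym (distribʳ _ _ _) ⟩
      (-σ⁻¹ + σ⁻¹) * row (toℕ q)             ≈⟨ trans (*-congʳ (-‿inverseˡ σ⁻¹)) (zeroˡ _) ⟩
      0#                                     ∎
    N·M-split (fsuc s) fzero = begin
      ∑ m (λ r → (P (toℕ s) r + Y * σ⁻¹ * z r) * col r) + (Y * -σ⁻¹) * corner
        ≈⟨ +-congʳ (trans (otherCol-expand (toℕ s) col) (+-congˡ (*-congˡ z·col≈row·y))) ⟩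
      (Y + (Y * σ⁻¹) * row·y) + (Y * -σ⁻¹) * corner
        ≈⟨ solve 5 (λ Y s n c e → (Y :+ (Y :* s) :* c) :+ (Y :* n) :* e := Y :+ Y :* (e :* n :+ c :* s))
                   refl Y σ⁻¹ -σ⁻¹ row·y corner ⟩
      Y + Y * (corner * -σ⁻¹ + row·y * σ⁻¹) ≈⟨ +-congˡ (*-congˡ schur-minus-one) ⟩
      Y + Y * (- 1#)                        ≈⟨ x-x≈0 Y ⟩
      0#                                    ∎
      where Y = y (toℕ s)
    N·M-split (fsuc s) (fsuc q) = begin
      ∑ m (λ r → (P (toℕ s) r + Y * σ⁻¹ * z r) * A r (toℕ q)) + (Y * -σ⁻¹) * R
        ≈⟨ +-congʳ (trans (otherCol-expand (toℕ s) (λ r → A r (toℕ q))) (+-cong (proj₂ A-inv s q) (*-congˡ (z·A≈row q)))) ⟩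
      (D + (Y * σ⁻¹) * R) + (Y * -σ⁻¹) * R
        ≈⟨ solve 5 (λ D Y s n R → (D :+ (Y :* s) :* R) :+ (Y :* n) :* R := D :+ (Y :* R) :* (s :+ n))
                   refl D Y σ⁻¹ -σ⁻¹ R ⟩
      D + (Y * R) * (σ⁻¹ + -σ⁻¹) ≈⟨ +-congˡ (trans (*-congˡ σ⁻¹-σ⁻¹) (zeroʳ _)) ⟩
      D + 0#                     ≈⟨ +-identityʳ D ⟩
      D                          ∎
      where Y = y (toℕ s); R = row (toℕ q); D = δ (toℕ s) (toℕ q)

    N·M : ∀ (a b : Fin (suc m)) → ∑ (suc m) (λ r → N (toℕ a) r * M r (toℕ b)) ≈ δ (toℕ a) (toℕ b)
    N·M a b = begin
      ∑ (suc m) (λ r → N (toℕ a) r * M r (toℕ b))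
        ≈⟨ ∑-last m (λ r → N (toℕ a) r * M r (toℕ b)) ⟩
      ∑ m (λ r → N (toℕ a) r * M r (toℕ b)) + N (toℕ a) m * M m (toℕ b)
        ≈⟨ +-cong (∑-cong m (λ r → *-congʳ (reflexive (N-other (toℕ a) r))))
                  (*-congʳ (reflexive (N-last (toℕ a)))) ⟩
      ∑ m (λ r → otherCol (toℕ a) r * M r (toℕ b)) + lastCol (toℕ a) * M m (toℕ b)
        ≈⟨ N·M-split a b ⟩
      δ (toℕ a) (toℕ b) ∎

    bordered-inverse : Σ Mat∞ (IsInverse (suc m) M)
    bordered-inverse = N , M·N , N·M

  -- Let block k be the matrix  t r (k + s)  (columns shifted by k).
  -- If the size-j block k is injective whenever j + k = n, all these blocks are
  -- invertible: the size-(1+j) block k is the size-j block (1+k) bordered by one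
  -- column on the left and one row at the bottom, so the bordering lemma applies.
  nested-blocks-invertible : ∀ (t : Mat∞) n →
    (∀ j k → j +ℕ k ≡ n → Injective j (λ r s → t r (k +ℕ s))) →
    ∀ j k → j +ℕ k ≡ n → Σ Mat∞ (IsInverse j (λ r s → t r (k +ℕ s)))
  nested-blocks-invertible t n injective zero    k e = (λ _ _ → 0#) , (λ ()) , (λ ())
  nested-blocks-invertible t n injective (suc j) k e =
    Bordering.bordered-inverse j (λ r s → t r (k +ℕ s)) P
      (IsInverse-cong {P = P} (λ r s → reflexive (cong (t r) (≡.sym (ℕₚ.+-suc k s)))) P-inv)
      (injective (suc j) k e)
    where
    inner : Σ Mat∞ (IsInverse j (λ r s → t r (suc k +ℕ s)))
    inner = nested-blocks-invertible t n injective j (suc k) (≡.trans (ℕₚ.+-suc j k) e)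
    P : Mat∞
    P = proj₁ inner
    P-inv : IsInverse j (λ r s → t r (suc k +ℕ s)) P
    P-inv = proj₂ inner

  vanish-split : ∀ q p (g : Vec∞) → (∀ (k : Fin q) → g (toℕ k) ≈ 0#) → (∀ (s : Fin p) → g (q +ℕ toℕ s) ≈ 0#) →
                 ∀ (l : Fin (q +ℕ p)) → g (toℕ l) ≈ 0#
  vanish-split zero    p g low high l        = high l
  vanish-split (suc q) p g low high fzero    = low fzero
  vanish-split (suc q) p g low high (fsuc l) = vanish-split q p (g ∘ suc) (low ∘ fsuc) high l

  placeAt : ℕ → Vec∞ → Vec∞
  placeAt zero    x n       = x n
  placeAt (suc q) x zero    = 0#
  placeAt (suc q) x (suc n) = placeAt q x n

  placeAt-shifted : ∀ q x s → placeAt q x (q +ℕ s) ≡ x s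
  placeAt-shifted zero    x s = ≡.refl
  placeAt-shifted (suc q) x s = placeAt-shifted q x s

  placeAt-below : ∀ q x n → n < q → placeAt q x n ≡ 0#
  placeAt-below (suc q) x zero    n<q       = ≡.refl
  placeAt-below (suc q) x (suc n) (s≤s n<q) = placeAt-below q x n n<q

module FinIndexed {c ℓ} (F : Field c ℓ) where
  open Field F
  open MatrixAlgebra F
  open FieldNotions F using (Mat; _⊗_; _≈ᴹᵃᵗ_; IdMat; Invertible; subBlock; Σᶠ)
  open import Algebra.Properties.Semiring.Sum semiring using (sum)

  Σᶠ≡sum : ∀ {n} (f : Fin n → Carrier) → Σᶠ f ≡ sum f
  Σᶠ≡sum {zero}  f = ≡.refl
  Σᶠ≡sum {suc n} f = cong (f fzero +_) (Σᶠ≡sum (f ∘ fsuc))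

  extend : ∀ {n} → (Fin n → Carrier) → Vec∞
  extend {zero}  f _       = 0#
  extend {suc n} f zero    = f fzero
  extend {suc n} f (suc k) = extend (f ∘ fsuc) k

  extend-toℕ : ∀ {n} (f : Fin n → Carrier) (a : Fin n) → extend f (toℕ a) ≡ f a
  extend-toℕ f fzero    = ≡.refl
  extend-toℕ f (fsuc a) = extend-toℕ (f ∘ fsuc) a

  extend-vanishes : ∀ {n p} (f : Fin n → Carrier) (P : ℕ → Set p) → (∀ l → P (toℕ l) → f l ≈ 0#) →
                    ∀ r → P r → extend f r ≈ 0#
  extend-vanishes {zero}  f P f≈0 r       Pr = refl
  extend-vanishes {suc n} f P f≈0 zero    Pr = f≈0 fzero Pr
  extend-vanishes {suc n} f P f≈0 (suc r) Pr = extend-vanishes (f ∘ fsuc) (P ∘ suc) (f≈0 ∘ fsuc) r Pr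

  extend₂ : ∀ {n} → Mat n → Mat∞
  extend₂ X r s = extend (λ a → extend (X a) s) r

  extend₂-toℕ : ∀ {n} (X : Mat n) (a b : Fin n) → extend₂ X (toℕ a) (toℕ b) ≡ X a b
  extend₂-toℕ X a b = ≡.trans (extend-toℕ (λ a' → extend (X a') (toℕ b)) a) (extend-toℕ (X a) b)

  IdMat≡δ : ∀ {n} (a b : Fin n) → IdMat a b ≡ δ (toℕ a) (toℕ b)
  IdMat≡δ fzero    fzero    = ≡.refl
  IdMat≡δ fzero    (fsuc b) = ≡.refl
  IdMat≡δ (fsuc a) fzero    = ≡.refl
  IdMat≡δ (fsuc a) (fsuc b) = IdMat≡δ a b

  Represents : ∀ {n} → Mat n → Mat∞ → Set ℓ
  Represents {n} X Y = ∀ (a b : Fin n) → X a b ≈ Y (toℕ a) (toℕ b)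

  invertible⇒inverse : ∀ {n} {X : Mat n} (Y : Mat∞) → Represents X Y → Invertible X → Σ Mat∞ (IsInverse n Y)
  invertible⇒inverse {n} {X} Y X≈Y (Q , XQ , QX) = extend₂ Q , YQ , QY
    where
    YQ : ∀ (a b : Fin n) → ∑ n (λ k → Y (toℕ a) k * extend₂ Q k (toℕ b)) ≈ δ (toℕ a) (toℕ b)
    YQ a b = trans (∑-cong n (λ k → *-cong (sym (X≈Y a k)) (reflexive (extend₂-toℕ Q k b))))
               (trans (reflexive (≡.sym (Σᶠ≡sum (λ k → X a k * Q k b))))
                 (trans (XQ a b) (reflexive (IdMat≡δ a b))))
    QY : ∀ (a b : Fin n) → ∑ n (λ k → extend₂ Q (toℕ a) k * Y k (toℕ b)) ≈ δ (toℕ a) (toℕ b)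
    QY a b = trans (∑-cong n (λ k → *-cong (reflexive (extend₂-toℕ Q a k)) (sym (X≈Y k b))))
               (trans (reflexive (≡.sym (Σᶠ≡sum (λ k → Q a k * X k b))))
                 (trans (QX a b) (reflexive (IdMat≡δ a b))))

  inverse⇒invertible : ∀ {n} {X : Mat n} (Y : Mat∞) → Represents X Y → Σ Mat∞ (IsInverse n Y) → Invertible X
  inverse⇒invertible {n} {X} Y X≈Y (N , YN , NY) = Q , XQ , QX
    where
    Q : Mat n
    Q a b = N (toℕ a) (toℕ b)
    XQ : (X ⊗ Q) ≈ᴹᵃᵗ IdMat
    XQ a b = trans (reflexive (Σᶠ≡sum (λ k → X a k * Q k b)))
               (trans (∑-cong n (λ k → *-congʳ (X≈Y a k)))
                 (trans (YN a b) (reflexive (≡.sym (IdMat≡δ a b)))))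
    QX : (Q ⊗ X) ≈ᴹᵃᵗ IdMat
    QX a b = trans (reflexive (Σᶠ≡sum (λ k → Q a k * X k b)))
               (trans (∑-cong n (λ k → *-congˡ (X≈Y k b)))
                 (trans (NY a b) (reflexive (≡.sym (IdMat≡δ a b)))))

  invertible⇒injective : ∀ {n} {X : Mat n} (Y : Mat∞) → Represents X Y → Invertible X → Injective n Y
  invertible⇒injective Y X≈Y X-inv = inverse⇒injective {A = Y} {P = proj₁ Y⁻¹} (proj₂ Y⁻¹)
    where
    Y⁻¹ : Σ Mat∞ (IsInverse _ Y)
    Y⁻¹ = invertible⇒inverse Y X≈Y X-inv

  subBlock-represents : ∀ {d} (T : Mat (suc d)) (i : Fin (suc d)) →
                        Represents (subBlock T i) (λ r s → extend₂ T r (toℕ i +ℕ s))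
  subBlock-represents T i a b = reflexive (≡.trans (≡.sym (extend₂-toℕ T _ _))
    (≡.cong₂ (extend₂ T) (toℕ-inject≤ a _) (≡.trans (toℕ-cast _ _) (toℕ-↑ʳ (toℕ i) b))))

module LinearCombinations {c ℓ m ℓm} (F : Field c ℓ) (V : Module (Field.commutativeRing F) m ℓm) where
  open Field F
  open FieldNotions F using (Σᶠ)
  open FieldNotions.VectorSpace F V using (lincomb; LinearlyIndependent)
  open Module V using (Carrierᴹ; _≈ᴹ_; _+ᴹ_; 0ᴹ; _*ₗ_; ≈ᴹ-setoid; ≈ᴹ-refl; ≈ᴹ-sym; ≈ᴹ-trans;
    +ᴹ-cong; +ᴹ-identityˡ; +ᴹ-group; +ᴹ-commutativeMonoid;
    *ₗ-congʳ; *ₗ-zeroˡ; *ₗ-zeroʳ; *ₗ-distribˡ; *ₗ-distribʳ; *ₗ-assoc)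
  open import Algebra.Properties.CommutativeSemigroup
    (CommutativeMonoid.commutativeSemigroup +ᴹ-commutativeMonoid) using (interchange)
  open import Algebra.Properties.Group +ᴹ-group using (identityˡ-unique)
  open import Algebra.Properties.Group +-group using (x∙y⁻¹≈ε⇒x≈y)
  open import Relation.Binary.Reasoning.Setoid ≈ᴹ-setoid

  lincomb-cong : ∀ {n} {p q : Fin n → Carrier} (w : Fin n → Carrierᴹ) → (∀ k → p k ≈ q k) →
                 lincomb p w ≈ᴹ lincomb q w
  lincomb-cong {zero}  w p≈q = ≈ᴹ-refl
  lincomb-cong {suc n} w p≈q = +ᴹ-cong (*ₗ-congʳ (p≈q fzero)) (lincomb-cong (w ∘ fsuc) (p≈q ∘ fsuc))

  lincomb-zero : ∀ {n} {p : Fin n → Carrier} (w : Fin n → Carrierᴹ) → (∀ k → p k ≈ 0#) → lincomb p w ≈ᴹ 0ᴹ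
  lincomb-zero {zero}  w p≈0 = ≈ᴹ-refl
  lincomb-zero {suc n} w p≈0 = ≈ᴹ-trans (+ᴹ-cong (≈ᴹ-trans (*ₗ-congʳ (p≈0 fzero)) (*ₗ-zeroˡ _))
                                                 (lincomb-zero (w ∘ fsuc) (p≈0 ∘ fsuc)))
                                        (+ᴹ-identityˡ 0ᴹ)

  lincomb-+ : ∀ {n} (p q : Fin n → Carrier) (w : Fin n → Carrierᴹ) →
              lincomb (λ k → p k + q k) w ≈ᴹ lincomb p w +ᴹ lincomb q w
  lincomb-+ {zero}  p q w = ≈ᴹ-sym (+ᴹ-identityˡ 0ᴹ)
  lincomb-+ {suc n} p q w = begin
    (p fzero + q fzero) *ₗ w fzero +ᴹ lincomb (λ k → p (fsuc k) + q (fsuc k)) (w ∘ fsuc)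
      ≈⟨ +ᴹ-cong (*ₗ-distribʳ _ _ _) (lincomb-+ (p ∘ fsuc) (q ∘ fsuc) (w ∘ fsuc)) ⟩
    (p fzero *ₗ w fzero +ᴹ q fzero *ₗ w fzero) +ᴹ (lincomb (p ∘ fsuc) (w ∘ fsuc) +ᴹ lincomb (q ∘ fsuc) (w ∘ fsuc))
      ≈⟨ interchange _ _ _ _ ⟩
    lincomb p w +ᴹ lincomb q w ∎

  lincomb-scale : ∀ {n} a (p : Fin n → Carrier) (w : Fin n → Carrierᴹ) →
                  a *ₗ lincomb p w ≈ᴹ lincomb (λ k → p k * a) w
  lincomb-scale {zero}  a p w = *ₗ-zeroʳ a
  lincomb-scale {suc n} a p w = begin
    a *ₗ (p fzero *ₗ w fzero +ᴹ lincomb (p ∘ fsuc) (w ∘ fsuc))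
      ≈⟨ *ₗ-distribˡ a _ _ ⟩
    a *ₗ (p fzero *ₗ w fzero) +ᴹ a *ₗ lincomb (p ∘ fsuc) (w ∘ fsuc)
      ≈⟨ +ᴹ-cong (≈ᴹ-trans (≈ᴹ-sym (*ₗ-assoc a _ _)) (*ₗ-congʳ (*-comm a _))) (lincomb-scale a (p ∘ fsuc) (w ∘ fsuc)) ⟩
    lincomb (λ k → p k * a) w ∎

  lincomb-lincomb : ∀ {n p} (C : Fin n → Fin p → Carrier) (b : Fin n → Carrier) (w : Fin p → Carrierᴹ) →
                    lincomb b (λ k → lincomb (C k) w) ≈ᴹ lincomb (λ l → Σᶠ (λ k → C k l * b k)) w
  lincomb-lincomb {zero}  C b w = ≈ᴹ-sym (lincomb-zero w (λ l → refl))
  lincomb-lincomb {suc n} C b w = begin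
    b fzero *ₗ lincomb (C fzero) w +ᴹ lincomb (b ∘ fsuc) (λ k → lincomb (C (fsuc k)) w)
      ≈⟨ +ᴹ-cong (lincomb-scale (b fzero) (C fzero) w) (lincomb-lincomb (C ∘ fsuc) (b ∘ fsuc) w) ⟩
    lincomb (λ l → C fzero l * b fzero) w +ᴹ lincomb (λ l → Σᶠ (λ k → C (fsuc k) l * b (fsuc k))) w
      ≈⟨ ≈ᴹ-sym (lincomb-+ _ _ w) ⟩
    lincomb (λ l → Σᶠ (λ k → C k l * b k)) w ∎

  coefficients-unique : ∀ {n} {w : Fin n → Carrierᴹ} → LinearlyIndependent w →
                        ∀ (p q : Fin n → Carrier) → lincomb p w ≈ᴹ lincomb q w → ∀ k → p k ≈ q k
  coefficients-unique {w = w} indep p q p≈q k = x∙y⁻¹≈ε⇒x≈y (p k) (q k) (indep (λ k → p k - q k) difference≈0 k)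
    where
    difference≈0 : lincomb (λ k → p k - q k) w ≈ᴹ 0ᴹ
    difference≈0 = identityˡ-unique _ _ (begin
      lincomb (λ k → p k - q k) w +ᴹ lincomb q w ≈⟨ ≈ᴹ-sym (lincomb-+ _ q w) ⟩
      lincomb (λ k → (p k - q k) + q k) w      ≈⟨ lincomb-cong w (λ k → x-y+y≈x (p k) (q k)) ⟩
      lincomb p w                              ≈⟨ p≈q ⟩
      lincomb q w                              ∎)
      where
      x-y+y≈x : ∀ x y → (x - y) + y ≈ x
      x-y+y≈x x y = trans (+-assoc _ _ _) (trans (+-congˡ (-‿inverseˡ y)) (+-identityʳ x))

module Flags {c ℓ m ℓm} (F : Field c ℓ) (V : Module (Field.commutativeRing F) m ℓm)
             (d : ℕ) (T : FieldNotions.Mat F (suc d)) (u : Fin (suc d) → Module.Carrierᴹ V)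
             (T-inv : FieldNotions.Invertible F T) (u-indep : FieldNotions.VectorSpace.LinearlyIndependent F V u) where
  open Field F
  open MatrixAlgebra F
  open FinIndexed F
  open LinearCombinations F V
  open FieldNotions F using (Σᶠ; Good)
  open FieldNotions.VectorSpace F V using (lincomb; Opposite; topSpan; transformBasis)
  open Module V using (Carrierᴹ; _≈ᴹ_; 0ᴹ; ≈ᴹ-refl; ≈ᴹ-sym; ≈ᴹ-trans)
  open import Relation.Binary.Reasoning.Setoid setoid

  t : Mat∞
  t = extend₂ T

  -- block k is T with its first k columns removed; its size-(d+1-k) part is T[k,d].
  block : ℕ → Mat∞
  block k r s = t r (k +ℕ s)

  v : Fin (suc d) → Carrierᴹ
  v = transformBasis T u

  coords : (Fin (suc d) → Carrier) → Fin (suc d) → Carrier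
  coords b l = Σᶠ (λ k → T l k * b k)

  v-combination : ∀ b → lincomb b v ≈ᴹ lincomb (coords b) u
  v-combination b = lincomb-lincomb (λ k l → T l k) b u

  T-represents : Represents T t
  T-represents a b = reflexive (≡.sym (extend₂-toℕ T a b))

  T-injective : Injective (suc d) t
  T-injective = invertible⇒injective t T-represents T-inv

  coords-as-∑ : ∀ b (g : Vec∞) → (∀ k → b k ≡ g (toℕ k)) →
                ∀ l → coords b l ≈ ∑ (suc d) (λ n → t (toℕ l) n * g n)
  coords-as-∑ b g b≡g l = trans (reflexive (Σᶠ≡sum (λ k → T l k * b k)))
                                (∑-cong (suc d) (λ k → *-cong (T-represents l k) (reflexive (b≡g k))))

  coords-from-block : ∀ q j → q +ℕ suc j ≡ suc d → ∀ b (g : Vec∞) → (∀ k → b k ≡ g (toℕ k)) →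
    (∀ (k : Fin q) → g (toℕ k) ≈ 0#) → ∀ l → coords b l ≈ ∑ (suc j) (λ s → block q (toℕ l) s * g (q +ℕ s))
  coords-from-block q j q+1+j≡1+d b g b≡g g-low l = begin
    coords b l                                  ≈⟨ coords-as-∑ b g b≡g l ⟩
    ∑ (suc d) (λ n → t (toℕ l) n * g n)         ≡⟨ cong (λ p → ∑ p (λ n → t (toℕ l) n * g n)) (≡.sym q+1+j≡1+d) ⟩
    ∑ (q +ℕ suc j) (λ n → t (toℕ l) n * g n)    ≈⟨ ∑-skip q (suc j) (λ n → t (toℕ l) n * g n) (λ k → trans (*-congˡ (g-low k)) (zeroʳ _)) ⟩
    ∑ (suc j) (λ s → block q (toℕ l) s * g (q +ℕ s)) ∎

  InTop : (Fin (suc d) → Carrierᴹ) → ℕ → Carrierᴹ → Set (c ⊔ ℓ ⊔ ℓm)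
  InTop w i x = ∃ λ coef → (∀ k → toℕ k +ℕ i < d → coef k ≈ 0#) × x ≈ᴹ lincomb coef w

  Opposite-at : Set (c ⊔ ℓ ⊔ m ⊔ ℓm)
  Opposite-at = ∀ i j → i +ℕ j < d → ∀ x → InTop u i x → InTop v j x → x ≈ᴹ 0ᴹ

  opposite-at : Opposite (topSpan u) (topSpan v) → Opposite-at
  opposite-at opp i j i+j<d =
    at-fromℕ< {P = λ i → ∀ j → i +ℕ j < d → ∀ x → InTop u i x → InTop v j x → x ≈ᴹ 0ᴹ}
      (λ i' j i'+j<d → at-fromℕ< {P = λ j → toℕ i' +ℕ j < d → ∀ x → InTop u (toℕ i') x → InTop v j x → x ≈ᴹ 0ᴹ}
                                  (opp i') j (below (ℕₚ.m≤n+m j (toℕ i')) i'+j<d) i'+j<d)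
      i (below (ℕₚ.m≤m+n i j) i+j<d) j i+j<d
    where
    below : ∀ {n s} → n ≤ s → s < d → n < suc d
    below n≤s s<d = s≤s (ℕₚ.≤-trans n≤s (ℕₚ.<⇒≤ s<d))

  BlocksInjective : Set (c ⊔ ℓ)
  BlocksInjective = ∀ j k → j +ℕ k ≡ suc d → Injective j (block k)

  good⇒blocks-injective : Good T → BlocksInjective
  good⇒blocks-injective good zero    k e = λ _ _ ()
  good⇒blocks-injective good (suc j) k e =
    ≡.subst (λ n → Injective n (block k)) size
      (at-fromℕ< {P = λ n → Injective (suc d ∸ n) (block n)}
        (λ i → invertible⇒injective (block (toℕ i)) (subBlock-represents T i) (good i))
        k (≡.subst (k <_) e (ℕₚ.m<n+m k (s≤s z≤n))))
    where
    size : suc d ∸ k ≡ suc j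
    size = ≡.trans (cong (_∸ k) (≡.sym e)) (ℕₚ.m+n∸n≡m (suc j) k)

  blocks-injective⇒good : BlocksInjective → Good T
  blocks-injective⇒good injective i =
    inverse⇒invertible (block (toℕ i)) (subBlock-represents T i)
      (nested-blocks-invertible t (suc d) injective (suc d ∸ toℕ i) (toℕ i) (ℕₚ.m∸n+n≡m (ℕₚ.<⇒≤ (toℕ<n i))))

  -- If the flags are opposite, the block T[1+k,d] (size 1+j, where j + 1 + k = d) is injective:
  -- for x in its kernel, w = Σ_l x_{l-1-k} v_l lies in U''_j and, by the kernel condition,
  -- in U'_k; so w = 0 and, T being injective, x = 0.
  opposite⇒shifted-block-injective : Opposite-at → ∀ j k → j +ℕ suc k ≡ d → Injective (suc j) (block (suc k))
  opposite⇒shifted-block-injective opposite j k j+1+k≡d x block·x≈0 a =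
    trans (reflexive (≡.sym (placeAt-shifted q x (toℕ a))))
          (at-fromℕ< {P = λ n → g n ≈ 0#} g≈0 (q +ℕ toℕ a)
                     (≡.subst (q +ℕ toℕ a <_) q+1+j≡1+d (ℕₚ.+-monoʳ-< q (toℕ<n a))))
    where
    q : ℕ
    q = suc k
    q+1+j≡1+d : q +ℕ suc j ≡ suc d
    q+1+j≡1+d = cong suc (≡.trans (ℕₚ.+-comm k (suc j)) (≡.trans (≡.sym (ℕₚ.+-suc j k)) j+1+k≡d))
    g : Vec∞
    g = placeAt q x
    b : Fin (suc d) → Carrier
    b l = g (toℕ l)
    w : Carrierᴹ
    w = lincomb b v
    w∈U'' : InTop v j w
    w∈U'' = b , (λ l l+j<d → reflexive (placeAt-below q x (toℕ l) (ℕₚ.+-cancelʳ-< j (toℕ l) q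
                  (≡.subst (toℕ l +ℕ j <_) (≡.trans (≡.sym j+1+k≡d) (ℕₚ.+-comm j q)) l+j<d)))) , ≈ᴹ-refl
    w∈U' : InTop u k w
    w∈U' = coords b , (λ l l+k<d → trans (coords≈block·x l) (at-fromℕ< {P = λ r → ∑ (suc j) (λ s → block q r s * x s) ≈ 0#}
                         block·x≈0 (toℕ l) (ℕₚ.+-cancelʳ-< k (toℕ l) (suc j)
                           (≡.subst (toℕ l +ℕ k <_) (≡.trans (≡.sym j+1+k≡d) (ℕₚ.+-suc j k)) l+k<d)))) , v-combination b
      where
      coords≈block·x : ∀ l → coords b l ≈ ∑ (suc j) (λ s → block q (toℕ l) s * x s)
      coords≈block·x l = trans (coords-from-block q j q+1+j≡1+d b g (λ _ → ≡.refl)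
                                  (λ k → reflexive (placeAt-below q x (toℕ k) (toℕ<n k))) l)
                               (∑-cong (suc j) (λ s → *-congˡ {block q (toℕ l) (toℕ s)} (reflexive (placeAt-shifted q x (toℕ s)))))
    w≈0 : w ≈ᴹ 0ᴹ
    w≈0 = opposite k j (ℕₚ.≤-reflexive (≡.trans (cong suc (ℕₚ.+-comm k j)) (≡.trans (≡.sym (ℕₚ.+-suc j k)) j+1+k≡d)))
                   w w∈U' w∈U''
    g≈0 : ∀ (l : Fin (suc d)) → g (toℕ l) ≈ 0#
    g≈0 = T-injective g (λ l → trans (sym (coords-as-∑ b g (λ _ → ≡.refl) l))
                                      (u-indep (coords b) (≈ᴹ-trans (≈ᴹ-sym (v-combination b)) w≈0) l))

  opposite⇒blocks-injective : Opposite-at → BlocksInjective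
  opposite⇒blocks-injective opposite zero    k       e = λ _ _ ()
  opposite⇒blocks-injective opposite (suc j) zero    e =
    ≡.subst (λ n → Injective n t) (≡.sym (≡.trans (≡.sym (ℕₚ.+-identityʳ (suc j))) e)) T-injective
  opposite⇒blocks-injective opposite (suc j) (suc k) e =
    opposite⇒shifted-block-injective opposite j k (ℕₚ.suc-injective e)

  -- If the blocks are injective, the flags are opposite: for x in U'_i ∩ U''_j write
  -- x = Σ b_l v_l with b_l = 0 for l < q = d - j.  Comparing u-coordinates, the rows
  -- 0..j of T[q,d] kill (b_q, ..., b_d), since those rows of x's u-coordinates vanish
  -- (l + i ≤ j + i < d); by injectivity of T[q,d] all of b vanishes, so x = 0.
  blocks-injective⇒opposite : BlocksInjective → Opposite (topSpan u) (topSpan v)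
  blocks-injective⇒opposite injective i j i+j<d x (a , a-low , x≈a·u) (b , b-low , x≈b·v) =
    ≈ᴹ-trans x≈b·v (lincomb-zero v b≈0)
    where
    jj q : ℕ
    jj = toℕ j
    q  = d ∸ jj
    jj≤d : jj ≤ d
    jj≤d = ℕₚ.≤-trans (ℕₚ.m≤n+m jj (toℕ i)) (ℕₚ.<⇒≤ i+j<d)
    q+1+j≡1+d : q +ℕ suc jj ≡ suc d
    q+1+j≡1+d = ≡.trans (ℕₚ.+-suc q jj) (cong suc (ℕₚ.m∸n+n≡m jj≤d))
    g : Vec∞
    g = extend b
    b≡g : ∀ k → b k ≡ g (toℕ k)
    b≡g k = ≡.sym (extend-toℕ b k)
    g-low : ∀ (k : Fin q) → g (toℕ k) ≈ 0#
    g-low k = extend-vanishes b (λ r → r +ℕ jj < d) b-low (toℕ k)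
                (≡.subst (toℕ k +ℕ jj <_) (ℕₚ.m∸n+n≡m jj≤d) (ℕₚ.+-monoˡ-< jj (toℕ<n k)))
    a≈coords : ∀ l → a l ≈ coords b l
    a≈coords = coefficients-unique {w = u} u-indep a (coords b) (≈ᴹ-trans (≈ᴹ-sym x≈a·u) (≈ᴹ-trans x≈b·v (v-combination b)))
    BlockRowZero : ℕ → Set ℓ
    BlockRowZero r = ∑ (suc jj) (λ s → block q r s * g (q +ℕ s)) ≈ 0#
    block-row-zero : ∀ (l : Fin (suc d)) → toℕ l ≤ jj → BlockRowZero (toℕ l)
    block-row-zero l l≤jj = begin
      ∑ (suc jj) (λ s → block q (toℕ l) s * g (q +ℕ s)) ≈⟨ sym (coords-from-block q jj q+1+j≡1+d b g b≡g g-low l) ⟩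
      coords b l                                         ≈⟨ sym (a≈coords l) ⟩
      a l                                                ≈⟨ a-low l l+i<d ⟩
      0#                                                 ∎
      where
      l+i<d : toℕ l +ℕ toℕ i < d
      l+i<d = ℕₚ.≤-<-trans (ℕₚ.≤-trans (ℕₚ.+-monoˡ-≤ (toℕ i) l≤jj) (ℕₚ.≤-reflexive (ℕₚ.+-comm jj (toℕ i)))) i+j<d
    g-high : ∀ (s : Fin (suc jj)) → g (q +ℕ toℕ s) ≈ 0#
    g-high = injective (suc jj) q (≡.trans (ℕₚ.+-comm (suc jj) q) q+1+j≡1+d) (λ s → g (q +ℕ s))
               (λ r → at-fromℕ< {P = λ n → n ≤ jj → BlockRowZero n} block-row-zero (toℕ r)
                        (s≤s (ℕₚ.≤-trans (ℕₚ.≤-pred (toℕ<n r)) jj≤d)) (ℕₚ.≤-pred (toℕ<n r)))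
    b≈0 : ∀ l → b l ≈ 0#
    b≈0 l = trans (reflexive (b≡g l))
                  (≡.subst (λ n → ∀ (l : Fin n) → g (toℕ l) ≈ 0#) q+1+j≡1+d (vanish-split q (suc jj) g g-low g-high) l)

proposition4p10 : ∀ {c ℓ m ℓm : Level} (F : Field c ℓ) (d : ℕ)
    (V : Module (Field.commutativeRing F) m ℓm)
    (T : FieldNotions.Mat F (suc d))
    (u : Fin (suc d) → Module.Carrierᴹ V) →
    FieldNotions.Invertible F T →
    FieldNotions.UpperTriangular F T →
    FieldNotions.VectorSpace.IsBasis F V u →
    FieldNotions.VectorSpace.Opposite F V
      (FieldNotions.VectorSpace.topSpan F V u)
      (FieldNotions.VectorSpace.topSpan F V (FieldNotions.VectorSpace.transformBasis F V T u))
    ⇔ FieldNotions.Good F T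
proposition4p10 F d V T u T-inv _ (u-indep , _) =
  mk⇔ (λ opposite → blocks-injective⇒good (opposite⇒blocks-injective (opposite-at opposite)))
      (λ good → blocks-injective⇒opposite (good⇒blocks-injective good))
  where open Flags F V d T u T-inv u-indep
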